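{- Let $\mathcal M$ be a multiset of perfect matchings of the Petersen graph $P$, and let $\mathcal N$ be a set of pairwise disjoint perfect matchings of $P^{\mathcal M}$. Then there is at most one $i \in \{0,\dots,5\}$ such that $n_{\mathcal N_P}(i) > n_{\mathcal M}(i)$. In particular, there is no triple of distinct vertices $u,v,w$ of $P^{\mathcal M}$, with $w$ adjacent to both $u$ and $v$, such that every edge of $P^{\mathcal M}$ joining $w$ to $u$ or to $v$ belongs to some perfect matching in $\mathcal N$.
   Context: Graphs may have parallel edges but no loops. $P$ denotes the Petersen graph, with outer 5-cycle $u_1u_2u_3u_4u_5$, inner vertices $v_1,\dots,v_5$ and spokes $u_iv_i$. It is known that $P$ has exactly six perfect matchings and each edge of $P$ lies in exactly two of them (any two distinct perfect matchings share exactly one edge). Let $M_0 = \{u_iv_i : i=1,\dots,5\}$ and, for $i \in \{1,\dots,5\}$, let $M_i$ be the unique perfect matching of $P$ other than $M_0$ containing $u_iv_i$; so $M_0,\dots,M_5$ are all the perfect matchings of $P$. For a multiset $\mathcal M$ of perfect matchings of $P$, $n_{\mathcal M}(i)$ is the number of copies of $M_i$ in $\mathcal M$, and $P^{\mathcal M}$ is the graph obtained from $P$ by adding, for each $F \in \mathcal M$ (with multiplicity), a new parallel copy of every edge of $F$. Every perfect matching of $P^{\mathcal M}$ becomes a perfect matching of $P$ by remembering only the end-vertices of its edges; for a multiset $\mathcal N$ of perfect matchings of $P^{\mathcal M}$, $\mathcal N_P$ denotes the resulting multiset of perfect matchings of $P$. -}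

module Defs where

open import Data.Nat using (ℕ; zero; suc; _+_; _<_)
open import Data.Nat.DivMod using (_mod_)
open import Data.Fin using (Fin; zero; suc; toℕ)
open import Data.Fin.Properties using () renaming (_≟_ to _≟F_)
open import Data.List using (List; []; _∷_; map; _++_; allFin)
open import Data.Bool using (Bool; true; false; _∧_; _∨_; not; _xor_; if_then_else_)
open import Data.Product using (Σ; _,_; proj₁; proj₂; _×_)
open import Data.Sum using (_⊎_)
open import Relation.Nullary.Decidable using (⌊_⌋)
open import Relation.Binary.PropositionalEquality using (_≡_; refl)
open import Data.Empty using (⊥)

countL : {A : Set} → (A → Bool) → List A → ℕ
countL f []       = 0
countL f (x ∷ xs) = if f x then suc (countL f xs) else countL f xs

anyL : {A : Set} → (A → Bool) → List A → Bool
anyL f []       = false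
anyL f (x ∷ xs) = f x ∨ anyL f xs

allL : {A : Set} → (A → Bool) → List A → Bool
allL f []       = true
allL f (x ∷ xs) = f x ∧ allL f xs

sumL : {A : Set} → (A → ℕ) → List A → ℕ
sumL f []       = 0
sumL f (x ∷ xs) = f x + sumL f xs

eqB : Bool → Bool → Bool
eqB a b = not (a xor b)

-- The Petersen graph P.
-- Indices 1..5 of the paper are represented by Fin 5 (0..4);
-- index arithmetic is modulo 5.

_⊕_ : Fin 5 → ℕ → Fin 5
i ⊕ k = (toℕ i + k) mod 5

data Vertex : Set where
  u : Fin 5 → Vertex
  v : Fin 5 → Vertex

_==V_ : Vertex → Vertex → Bool
u i ==V u j = ⌊ i ≟F j ⌋
v i ==V v j = ⌊ i ≟F j ⌋
u _ ==V v _ = false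
v _ ==V u _ = false

allVertices : List Vertex
allVertices = map u (allFin 5) ++ map v (allFin 5)

data PEdge : Set where
  outer : Fin 5 → PEdge
  spoke : Fin 5 → PEdge
  inner : Fin 5 → PEdge

allPEdges : List PEdge
allPEdges = map outer (allFin 5) ++ map spoke (allFin 5) ++ map inner (allFin 5)

ends : PEdge → Vertex × Vertex
ends (outer i) = u i , u (i ⊕ 1)
ends (spoke i) = u i , v i
ends (inner i) = v i , v (i ⊕ 2)

incident : Vertex → PEdge → Bool
incident x e = (x ==V proj₁ (ends e)) ∨ (x ==V proj₂ (ends e))

Joins : PEdge → Vertex → Vertex → Set
Joins e x y = (proj₁ (ends e) ≡ x × proj₂ (ends e) ≡ y)
            ⊎ (proj₁ (ends e) ≡ y × proj₂ (ends e) ≡ x)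

EdgeSetP : Set
EdgeSetP = PEdge → Bool

IsPerfectMatchingP : EdgeSetP → Set
IsPerfectMatchingP S =
  ∀ x → countL (λ e → S e ∧ incident x e) allPEdges ≡ 1

PMP : Set
PMP = Σ EdgeSetP IsPerfectMatchingP

sameEdgeSet : EdgeSetP → EdgeSetP → Bool
sameEdgeSet S T = allL (λ e → eqB (S e) (T e)) allPEdges

-- Index zero : Fin 6 is M_0 = spokes;
-- index suc i (i : Fin 5, i.e. paper index i+1) is the unique perfect
-- matching other than M_0 containing the spoke u_i v_i, namely
-- {u_i v_i, u_{i+1}u_{i+2}, u_{i+3}u_{i+4}, v_{i+1}v_{i+3}, v_{i+2}v_{i+4}}.
Mset : Fin 6 → EdgeSetP
Mset zero    (outer _) = false
Mset zero    (spoke _) = true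
Mset zero    (inner _) = false
Mset (suc i) (spoke j) = ⌊ j ≟F i ⌋
Mset (suc i) (outer j) = ⌊ j ≟F (i ⊕ 1) ⌋ ∨ ⌊ j ≟F (i ⊕ 3) ⌋
Mset (suc i) (inner j) = ⌊ j ≟F (i ⊕ 1) ⌋ ∨ ⌊ j ≟F (i ⊕ 2) ⌋

sanity-pm : allL (λ i → allL (λ x → ⌊ countL (λ e → Mset i e ∧ incident x e) allPEdges Data.Nat.≟ 1 ⌋)
                               allVertices) (allFin 6) ≡ true
sanity-pm = refl

sanity-share : allL (λ i → allL (λ j → ⌊ i ≟F j ⌋ ∨ ⌊ countL (λ e → Mset i e ∧ Mset j e) allPEdges Data.Nat.≟ 1 ⌋)
                               (allFin 6)) (allFin 6) ≡ true
sanity-share = refl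

nP : List PMP → Fin 6 → ℕ
nP 𝓜 i = countL (λ F → sameEdgeSet (proj₁ F) (Mset i)) 𝓜

-- The multigraph P^𝓜: edge e of P has 1 + (number of F ∈ 𝓜 with e ∈ F)
-- parallel copies; copy zero is the original edge.

mult : List PMP → PEdge → ℕ
mult 𝓜 e = countL (λ F → proj₁ F e) 𝓜

EdgeM : List PMP → Set
EdgeM 𝓜 = Σ PEdge (λ e → Fin (suc (mult 𝓜 e)))

EdgeSetM : List PMP → Set
EdgeSetM 𝓜 = EdgeM 𝓜 → Bool

degIn : (𝓜 : List PMP) → EdgeSetM 𝓜 → Vertex → ℕ
degIn 𝓜 S x =
  sumL (λ e → countL (λ k → S (e , k) ∧ incident x e) (allFin (suc (mult 𝓜 e))))
       allPEdges

IsPerfectMatchingM : (𝓜 : List PMP) → EdgeSetM 𝓜 → Set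
IsPerfectMatchingM 𝓜 S = ∀ x → degIn 𝓜 S x ≡ 1

PMM : List PMP → Set
PMM 𝓜 = Σ (EdgeSetM 𝓜) (IsPerfectMatchingM 𝓜)

Disjoint : {𝓜 : List PMP} → PMM 𝓜 → PMM 𝓜 → Set
Disjoint {𝓜} N₁ N₂ = ∀ (f : EdgeM 𝓜) → proj₁ N₁ f ≡ true → proj₁ N₂ f ≡ true → ⊥

underlying : {𝓜 : List PMP} → PMM 𝓜 → EdgeSetP
underlying {𝓜} N e = anyL (λ k → proj₁ N (e , k)) (allFin (suc (mult 𝓜 e)))

nNP : {𝓜 : List PMP} → List (PMM 𝓜) → Fin 6 → ℕ
nNP {𝓜} 𝓝 i = countL (λ N → sameEdgeSet (underlying {𝓜} N) (Mset i)) 𝓝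

-- adjacency in P^𝓜 (same as in P, since only parallel edges are added)
AdjM : List PMP → Vertex → Vertex → Set
AdjM 𝓜 x y = Σ (EdgeM 𝓜) (λ f → Joins (proj₁ f) x y)

-- The ten degree conditions on the fifteen edges of P have exactly six solutions, so every
-- perfect matching of P is some Mₖ; moreover each edge e lies in exactly two of them, say M_a and M_b.
-- Hence in any family of perfect matchings of P the number of members containing e is n(a) + n(b); in
-- particular e has 1 + n_𝓜(a) + n_𝓜(b) parallel copies in P^𝓜.  A perfect matching of P^𝓜 uses at most
-- one copy of e, so pairwise disjoint ones give n_𝓝(a) + n_𝓝(b) ≤ 1 + n_𝓜(a) + n_𝓜(b), and since any two
-- distinct Mᵢ, Mⱼ share an edge, at most one index has n_𝓝(i) > n_𝓜(i).  If every copy of wx is used,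
-- the same count gives n_𝓝(a) + n_𝓝(b) ≥ 1 + n_𝓜(a) + n_𝓜(b), i.e. an excess at a matching through wx;
-- covering wy as well forces the same excess index, so a single Mᵢ would contain two edges at w.

module Submission where

open import Defs
open import Data.Nat using (ℕ; suc; _+_; _<_; _≤_; z≤n; s≤s; _≡ᵇ_; _<?_) renaming (_≟_ to _≟ℕ_)
open import Data.Nat.Properties
  using (≤-refl; ≤-trans; ≤-reflexive; +-mono-≤; +-suc; +-comm; +-cancelˡ-≤; n≤0⇒n≡0; ≤-pred; n≤1+n;
         n≮n; ≮⇒≥; m≤m+n; m≤n+m; ≡ᵇ⇒≡; +-commutativeSemigroup; module ≤-Reasoning)
open import Algebra.Properties.CommutativeSemigroup +-commutativeSemigroup using (interchange)
open import Data.Fin using (Fin; zero; suc)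
open import Data.Fin.Properties using () renaming (_≟_ to _≟F_)
open import Data.List using (List; []; _∷_; map; allFin; length)
open import Data.List.Properties using (length-tabulate; ∷-injective)
open import Data.List.Relation.Unary.Any using (Any; here; there; satisfied)
open import Data.List.Relation.Unary.All using (All; []; _∷_)
open import Data.List.Relation.Unary.AllPairs using (AllPairs; []; _∷_)
open import Data.List.Membership.Propositional using (_∈_; lose)
open import Data.List.Membership.Propositional.Properties using (∈-map⁺; ∈-++⁺ˡ; ∈-++⁺ʳ; ∈-allFin)
open import Data.Product using (Σ; _×_; _,_; proj₁; proj₂)
open import Data.Sum using (_⊎_; inj₁; inj₂; [_,_]′)
open import Data.Bool using (Bool; true; false; _∧_; _∨_; T)
open import Data.Bool.Properties using (T-≡; ∧-comm; ∧-identityʳ; ∧-zeroʳ; ∨-zeroʳ)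
open import Function.Bundles using (Equivalence)
open import Data.Empty using (⊥; ⊥-elim)
open import Relation.Binary.PropositionalEquality
  using (_≡_; _≢_; refl; sym; trans; cong; cong₂; subst; ≡-≟-identity; ≢-≟-identity; module ≡-Reasoning)
open import Relation.Nullary using (¬_; yes; no)
open import Relation.Nullary.Decidable using (⌊_⌋; toWitness; decidable-stable)

indicator : Bool → ℕ
indicator true  = 1
indicator false = 0

module _ {A : Set} where

  countL≡sumL : (f : A → Bool) (xs : List A) → countL f xs ≡ sumL (λ x → indicator (f x)) xs
  countL≡sumL f []       = refl
  countL≡sumL f (x ∷ xs) with f x
  ... | true  = cong suc (countL≡sumL f xs)
  ... | false = countL≡sumL f xs

  countL-cong : {f g : A → Bool} → (∀ x → f x ≡ g x) → (xs : List A) → countL f xs ≡ countL g xs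
  countL-cong f≡g []       = refl
  countL-cong {g = g} f≡g (x ∷ xs) rewrite f≡g x with g x
  ... | true  = cong suc (countL-cong f≡g xs)
  ... | false = countL-cong f≡g xs

  countL-∧true : (f : A → Bool) (xs : List A) → countL (λ x → f x ∧ true) xs ≡ countL f xs
  countL-∧true f []       = refl
  countL-∧true f (x ∷ xs) with f x
  ... | true  = cong suc (countL-∧true f xs)
  ... | false = countL-∧true f xs

  countL-∧false : (f : A → Bool) (xs : List A) → countL (λ x → f x ∧ false) xs ≡ 0
  countL-∧false f []       = refl
  countL-∧false f (x ∷ xs) with f x
  ... | true  = countL-∧false f xs
  ... | false = countL-∧false f xs

  countL≤1⇒≡indicator-anyL : (f : A → Bool) (xs : List A) → countL f xs ≤ 1 → countL f xs ≡ indicator (anyL f xs)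
  countL≤1⇒≡indicator-anyL f []       _ = refl
  countL≤1⇒≡indicator-anyL f (x ∷ xs) h with f x
  ... | true  = cong suc (n≤0⇒n≡0 (≤-pred h))
  ... | false = countL≤1⇒≡indicator-anyL f xs h

  indicator-anyL-∧ : (f : A → Bool) (xs : List A) (c : Bool) → countL f xs ≤ 1 →
    indicator (anyL f xs ∧ c) ≡ countL (λ x → f x ∧ c) xs
  indicator-anyL-∧ f xs true  h = begin
    indicator (anyL f xs ∧ true)  ≡⟨ cong indicator (∧-identityʳ (anyL f xs)) ⟩
    indicator (anyL f xs)         ≡⟨ sym (countL≤1⇒≡indicator-anyL f xs h) ⟩
    countL f xs                   ≡⟨ sym (countL-∧true f xs) ⟩
    countL (λ x → f x ∧ true) xs  ∎
    where open ≡-Reasoning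
  indicator-anyL-∧ f xs false h = trans (cong indicator (∧-zeroʳ (anyL f xs))) (sym (countL-∧false f xs))

  sumL-cong : {f g : A → ℕ} → (∀ x → f x ≡ g x) → (xs : List A) → sumL f xs ≡ sumL g xs
  sumL-cong f≡g []       = refl
  sumL-cong f≡g (x ∷ xs) = cong₂ _+_ (f≡g x) (sumL-cong f≡g xs)

  sumL-mono-≤ : {f g : A → ℕ} → (∀ x → f x ≤ g x) → (xs : List A) → sumL f xs ≤ sumL g xs
  sumL-mono-≤ f≤g []       = z≤n
  sumL-mono-≤ f≤g (x ∷ xs) = +-mono-≤ (f≤g x) (sumL-mono-≤ f≤g xs)

  sumL-+ : (f g : A → ℕ) (xs : List A) → sumL (λ x → f x + g x) xs ≡ sumL f xs + sumL g xs
  sumL-+ f g []       = refl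
  sumL-+ f g (x ∷ xs) =
    trans (cong (f x + g x +_) (sumL-+ f g xs)) (interchange (f x) (g x) (sumL f xs) (sumL g xs))

  sumL-const-0 : (xs : List A) → sumL (λ _ → 0) xs ≡ 0
  sumL-const-0 []       = refl
  sumL-const-0 (x ∷ xs) = sumL-const-0 xs

  sumL-const-1 : (xs : List A) → sumL (λ _ → 1) xs ≡ length xs
  sumL-const-1 []       = refl
  sumL-const-1 (x ∷ xs) = cong suc (sumL-const-1 xs)

  ≤-sumL : (f : A → ℕ) {x : A} {xs : List A} → x ∈ xs → f x ≤ sumL f xs
  ≤-sumL f {xs = y ∷ ys} (here refl) = m≤m+n (f y) (sumL f ys)
  ≤-sumL f {xs = y ∷ ys} (there x∈ys) = ≤-trans (≤-sumL f x∈ys) (m≤n+m (sumL f ys) (f y))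

sumL-swap : {A B : Set} (h : A → B → ℕ) (xs : List A) (ys : List B) →
  sumL (λ x → sumL (h x) ys) xs ≡ sumL (λ y → sumL (λ x → h x y) xs) ys
sumL-swap h []       ys = sym (sumL-const-0 ys)
sumL-swap h (x ∷ xs) ys = begin
  sumL (h x) ys + sumL (λ x → sumL (h x) ys) xs         ≡⟨ cong (sumL (h x) ys +_) (sumL-swap h xs ys) ⟩
  sumL (h x) ys + sumL (λ y → sumL (λ x → h x y) xs) ys ≡⟨ sym (sumL-+ (h x) _ ys) ⟩
  sumL (λ y → h x y + sumL (λ x → h x y) xs) ys         ∎
  where open ≡-Reasoning

suc-+-≤⇒<⊎< : ∀ {a b c d} → suc (a + b) ≤ c + d → a < c ⊎ b < d
suc-+-≤⇒<⊎< {a} {b} {c} {d} h with a <? c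
... | yes a<c = inj₁ a<c
... | no  a≮c = inj₂ (+-cancelˡ-≤ a _ _ (begin
  a + suc b  ≡⟨ +-suc a b ⟩
  suc (a + b) ≤⟨ h ⟩
  c + d       ≤⟨ +-mono-≤ (≮⇒≥ a≮c) ≤-refl ⟩
  a + d       ∎))
  where open ≤-Reasoning

module _ {A : Set} (f : A → Bool) where

  countL≤1-AllPairs : {R : A → A → Set} → (∀ {x y} → R x y → f x ≡ true → f y ≡ true → ⊥) →
    {xs : List A} → AllPairs R xs → countL f xs ≤ 1
  countL≤1-AllPairs         excl {[]}     []              = z≤n
  countL≤1-AllPairs {R = R} excl {x ∷ xs} (Rx-xs ∷ pairs) with f x in fx
  ... | true  = s≤s (≤-reflexive (none Rx-xs))
    where
    none : ∀ {ys} → All (R x) ys → countL f ys ≡ 0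
    none {[]}     []            = refl
    none {y ∷ ys} (Rxy ∷ Rx-ys) with f y in fy
    ... | true  = ⊥-elim (excl Rxy fx fy)
    ... | false = none Rx-ys
  ... | false = countL≤1-AllPairs excl pairs

  Any⇒countL-pos : {xs : List A} → Any (λ x → f x ≡ true) xs → 1 ≤ countL f xs
  Any⇒countL-pos {x ∷ xs} (here fx) rewrite fx = s≤s z≤n
  Any⇒countL-pos {x ∷ xs} (there p) with f x
  ... | true  = s≤s z≤n
  ... | false = Any⇒countL-pos p

  countL-pos⇒Any : (xs : List A) → 1 ≤ countL f xs → Any (λ x → f x ≡ true) xs
  countL-pos⇒Any (x ∷ xs) h with f x in fx
  ... | true  = here fx
  ... | false = there (countL-pos⇒Any xs h)

  countL≥2 : {x y : A} (xs : List A) → x ∈ xs → y ∈ xs → x ≢ y → f x ≡ true → f y ≡ true → 2 ≤ countL f xs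
  countL≥2 _ (here refl) (here refl) x≢y _ _ = ⊥-elim (x≢y refl)
  countL≥2 _ (here refl) (there y∈) _ fx fy rewrite fx = s≤s (Any⇒countL-pos (lose y∈ fy))
  countL≥2 _ (there x∈) (here refl) _ fx fy rewrite fy = s≤s (Any⇒countL-pos (lose x∈ fx))
  countL≥2 (z ∷ zs) (there x∈) (there y∈) x≢y fx fy with f z
  ... | true  = ≤-trans (countL≥2 zs x∈ y∈ x≢y fx fy) (n≤1+n _)
  ... | false = countL≥2 zs x∈ y∈ x≢y fx fy

  allL-sound : {xs : List A} → allL f xs ≡ true → ∀ {x} → x ∈ xs → f x ≡ true
  allL-sound {y ∷ ys} h (here refl) with f y
  ... | true = refl
  allL-sound {y ∷ ys} h (there x∈) with f y
  ... | true = allL-sound h x∈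

∧-true : ∀ {a b} → a ∧ b ≡ true → a ≡ true × b ≡ true
∧-true {true} {true} _ = refl , refl

≡true⇒T : {b : Bool} → b ≡ true → T b
≡true⇒T = Equivalence.from T-≡

allL²-sound : {A B : Set} (p : A → B → Bool) {xs : List A} {ys : List B} →
  allL (λ x → allL (p x) ys) xs ≡ true → ∀ {x y} → x ∈ xs → y ∈ ys → p x y ≡ true
allL²-sound p {ys = ys} h x∈ y∈ = allL-sound (p _) (allL-sound (λ x → allL (p x) ys) h x∈) y∈

⌊≟F⌋-refl : ∀ {n} (k : Fin n) → ⌊ k ≟F k ⌋ ≡ true
⌊≟F⌋-refl k = cong ⌊_⌋ (≡-≟-identity _≟F_ refl)

⌊≟F⌋-≢ : ∀ {n} {i j : Fin n} → i ≢ j → ⌊ i ≟F j ⌋ ≡ false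
⌊≟F⌋-≢ i≢j = cong ⌊_⌋ (≢-≟-identity _≟F_ i≢j)

map-≡⇒≡ : {A B : Set} {f g : A → B} {xs : List A} → map f xs ≡ map g xs → ∀ {x} → x ∈ xs → f x ≡ g x
map-≡⇒≡ {xs = y ∷ ys} eq (here refl) = proj₁ (∷-injective eq)
map-≡⇒≡ {xs = y ∷ ys} eq (there x∈) = map-≡⇒≡ (proj₂ (∷-injective eq)) x∈

data ExactlyOne : Bool → Bool → Bool → Set where
  first  : ExactlyOne true false false
  second : ExactlyOne false true false
  third  : ExactlyOne false false true

exactlyOne : {A : Set} (f : A → Bool) {a b c : A} → countL f (a ∷ b ∷ c ∷ []) ≡ 1 → ExactlyOne (f a) (f b) (f c)
exactlyOne f {a} {b} {c} h with f a | f b | f c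
exactlyOne f h  | true  | false | false = first
exactlyOne f h  | false | true  | false = second
exactlyOne f h  | false | false | true  = third
exactlyOne f () | true  | true  | _
exactlyOne f () | true  | false | true
exactlyOne f () | false | true  | true
exactlyOne f () | false | false | false

∈-allPEdges : ∀ e → e ∈ allPEdges
∈-allPEdges (outer i) = ∈-++⁺ˡ (∈-map⁺ outer (∈-allFin i))
∈-allPEdges (spoke i) = ∈-++⁺ʳ (map outer (allFin 5)) (∈-++⁺ˡ (∈-map⁺ spoke (∈-allFin i)))
∈-allPEdges (inner i) = ∈-++⁺ʳ (map outer (allFin 5)) (∈-++⁺ʳ (map spoke (allFin 5)) (∈-map⁺ inner (∈-allFin i)))

-- The arguments are the degree conditions at u₀,…,u₄,v₀,…,v₄, the bᵢ being the values of an edge set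
-- on allPEdges; the coverage checker confirms that these six clauses are the only solutions.
solveDegrees : ∀ {b₀ b₁ b₂ b₃ b₄ b₅ b₆ b₇ b₈ b₉ b₁₀ b₁₁ b₁₂ b₁₃ b₁₄} →
  ExactlyOne b₀ b₄ b₅ → ExactlyOne b₀ b₁ b₆ → ExactlyOne b₁ b₂ b₇ → ExactlyOne b₂ b₃ b₈ → ExactlyOne b₃ b₄ b₉ →
  ExactlyOne b₅ b₁₀ b₁₃ → ExactlyOne b₆ b₁₁ b₁₄ → ExactlyOne b₇ b₁₀ b₁₂ → ExactlyOne b₈ b₁₁ b₁₃ → ExactlyOne b₉ b₁₂ b₁₄ →
  Σ (Fin 6) λ k →
    b₀ ∷ b₁ ∷ b₂ ∷ b₃ ∷ b₄ ∷ b₅ ∷ b₆ ∷ b₇ ∷ b₈ ∷ b₉ ∷ b₁₀ ∷ b₁₁ ∷ b₁₂ ∷ b₁₃ ∷ b₁₄ ∷ [] ≡ map (Mset k) allPEdges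
solveDegrees third  third  third  third  third  first  first  first  first  first  = zero , refl
solveDegrees third  second first  second first  first  second third  second second = suc zero , refl
solveDegrees second third  second first  second third  first  third  third  second = suc (suc zero) , refl
solveDegrees first  first  third  second first  third  third  first  third  third  = suc (suc (suc zero)) , refl
solveDegrees second second first  third  second second third  second first  third  = suc (suc (suc (suc zero))) , refl
solveDegrees first  first  second first  third  second second second second first  = suc (suc (suc (suc (suc zero)))) , refl

classify : (S : EdgeSetP) → IsPerfectMatchingP S → Σ (Fin 6) λ k → ∀ e → S e ≡ Mset k e
classify S pm = k , λ e → map-≡⇒≡ {f = S} {g = Mset k} S≡Mₖ (∈-allPEdges e)
  where
  -- With incident x e first, this count reduces to countL S over the three edges at x.
  degree : ∀ x → countL (λ e → incident x e ∧ S e) allPEdges ≡ 1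
  degree x = trans (countL-cong (λ e → ∧-comm (incident x e) (S e)) allPEdges) (pm x)
  solution : Σ (Fin 6) λ k → map S allPEdges ≡ map (Mset k) allPEdges
  solution = solveDegrees
    (exactlyOne S (degree (u zero))) (exactlyOne S (degree (u (suc zero))))
    (exactlyOne S (degree (u (suc (suc zero))))) (exactlyOne S (degree (u (suc (suc (suc zero))))))
    (exactlyOne S (degree (u (suc (suc (suc (suc zero)))))))
    (exactlyOne S (degree (v zero))) (exactlyOne S (degree (v (suc zero))))
    (exactlyOne S (degree (v (suc (suc zero))))) (exactlyOne S (degree (v (suc (suc (suc zero))))))
    (exactlyOne S (degree (v (suc (suc (suc (suc zero)))))))
  k : Fin 6
  k = proj₁ solution
  S≡Mₖ : map S allPEdges ≡ map (Mset k) allPEdges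
  S≡Mₖ = proj₂ solution

through₁ through₂ : PEdge → Fin 6
through₁ (outer j) = suc (j ⊕ 4)
through₁ (spoke j) = zero
through₁ (inner j) = suc (j ⊕ 4)
through₂ (outer j) = suc (j ⊕ 2)
through₂ (spoke j) = suc j
through₂ (inner j) = suc (j ⊕ 3)

Mset-indicator : ∀ k e →
  indicator (Mset k e) ≡ indicator ⌊ k ≟F through₁ e ⌋ + indicator ⌊ k ≟F through₂ e ⌋
Mset-indicator k e = ≡ᵇ⇒≡ _ _ (≡true⇒T (allL²-sound check computed (∈-allPEdges e) (∈-allFin k)))
  where
  check : PEdge → Fin 6 → Bool
  check e k = indicator (Mset k e) ≡ᵇ (indicator ⌊ k ≟F through₁ e ⌋ + indicator ⌊ k ≟F through₂ e ⌋)
  computed : allL (λ e → allL (check e) (allFin 6)) allPEdges ≡ true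
  computed = refl

sameEdgeSet-Mset : ∀ i j → sameEdgeSet (Mset i) (Mset j) ≡ ⌊ i ≟F j ⌋
sameEdgeSet-Mset i j = eqB-sound (allL²-sound check computed (∈-allFin i) (∈-allFin j))
  where
  check : Fin 6 → Fin 6 → Bool
  check i j = eqB (sameEdgeSet (Mset i) (Mset j)) ⌊ i ≟F j ⌋
  computed : allL (λ i → allL (check i) (allFin 6)) (allFin 6) ≡ true
  computed = refl
  eqB-sound : ∀ {a b} → eqB a b ≡ true → a ≡ b
  eqB-sound {true}  {true}  _ = refl
  eqB-sound {false} {false} _ = refl

through-∈ : ∀ e → Mset (through₁ e) e ≡ true × Mset (through₂ e) e ≡ true
through-∈ e = ∧-true (allL-sound (λ e → Mset (through₁ e) e ∧ Mset (through₂ e) e) computed (∈-allPEdges e))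
  where
  computed : allL (λ e → Mset (through₁ e) e ∧ Mset (through₂ e) e) allPEdges ≡ true
  computed = refl

Mset-through : ∀ {k e} → Mset k e ≡ true → k ≡ through₁ e ⊎ k ≡ through₂ e
Mset-through {k} {e} k∋e with k ≟F through₁ e | k ≟F through₂ e | Mset-indicator k e
... | yes k≡t₁ | _        | _  = inj₁ k≡t₁
... | no _     | yes k≡t₂ | _  = inj₂ k≡t₂
... | no _     | no _     | eq with () ← trans (cong indicator (sym k∋e)) eq

through-pair : ∀ {i j e} → i ≢ j → Mset i e ≡ true → Mset j e ≡ true →
  (c : Fin 6 → ℕ) → c (through₁ e) + c (through₂ e) ≡ c i + c j
through-pair {i} {j} {e} i≢j i∋e j∋e c with Mset-through {i} {e} i∋e | Mset-through {j} {e} j∋e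
... | inj₁ refl | inj₁ refl = ⊥-elim (i≢j refl)
... | inj₁ refl | inj₂ refl = refl
... | inj₂ refl | inj₁ refl = +-comm (c _) (c _)
... | inj₂ refl | inj₂ refl = ⊥-elim (i≢j refl)

commonEdge : ∀ {i j} → i ≢ j → Σ PEdge λ e → Mset i e ≡ true × Mset j e ≡ true
commonEdge {i} {j} i≢j = e , ∧-true e∈Mᵢ∩Mⱼ
  where
  shared : PEdge → Bool
  shared e = Mset i e ∧ Mset j e
  shares : (⌊ i ≟F j ⌋ ∨ ⌊ countL shared allPEdges ≟ℕ 1 ⌋) ≡ true
  shares = allL²-sound (λ i j → ⌊ i ≟F j ⌋ ∨ ⌊ countL (λ e → Mset i e ∧ Mset j e) allPEdges ≟ℕ 1 ⌋)
                       sanity-share (∈-allFin i) (∈-allFin j)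
  shared≡1 : countL shared allPEdges ≡ 1
  shared≡1 = toWitness (≡true⇒T (trans (cong (_∨ ⌊ countL shared allPEdges ≟ℕ 1 ⌋) (sym (⌊≟F⌋-≢ i≢j))) shares))
  found : Σ PEdge λ e → shared e ≡ true
  found = satisfied (countL-pos⇒Any shared allPEdges (≤-reflexive (sym shared≡1)))
  e : PEdge
  e = proj₁ found
  e∈Mᵢ∩Mⱼ : shared e ≡ true
  e∈Mᵢ∩Mⱼ = proj₂ found

sameEdgeSet-congˡ : {S T : EdgeSetP} → (∀ e → S e ≡ T e) → ∀ U → sameEdgeSet S U ≡ sameEdgeSet T U
sameEdgeSet-congˡ S≡T U = allL-cong (λ e → cong (λ b → eqB b (U e)) (S≡T e)) allPEdges
  where
  allL-cong : {f g : PEdge → Bool} → (∀ x → f x ≡ g x) → ∀ xs → allL f xs ≡ allL g xs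
  allL-cong f≡g []       = refl
  allL-cong f≡g (x ∷ xs) = cong₂ _∧_ (f≡g x) (allL-cong f≡g xs)

sameEdgeSet-class : {S : EdgeSetP} {k : Fin 6} → (∀ e → S e ≡ Mset k e) → ∀ t → sameEdgeSet S (Mset t) ≡ ⌊ k ≟F t ⌋
sameEdgeSet-class {S} {k} S≡Mₖ t = trans (sameEdgeSet-congˡ S≡Mₖ (Mset t)) (sameEdgeSet-Mset k t)

indicator-through : (S : EdgeSetP) → IsPerfectMatchingP S → ∀ e →
  indicator (S e) ≡ indicator (sameEdgeSet S (Mset (through₁ e))) + indicator (sameEdgeSet S (Mset (through₂ e)))
indicator-through S pm e = begin
  indicator (S e)                                                 ≡⟨ cong indicator (S≡Mₖ e) ⟩
  indicator (Mset k e)                                            ≡⟨ Mset-indicator k e ⟩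
  indicator ⌊ k ≟F through₁ e ⌋ + indicator ⌊ k ≟F through₂ e ⌋   ≡⟨ sym (cong₂ _+_ (same (through₁ e)) (same (through₂ e))) ⟩
  indicator (sameEdgeSet S (Mset (through₁ e))) + indicator (sameEdgeSet S (Mset (through₂ e))) ∎
  where
  open ≡-Reasoning
  k : Fin 6
  k = proj₁ (classify S pm)
  S≡Mₖ : ∀ e → S e ≡ Mset k e
  S≡Mₖ = proj₂ (classify S pm)
  same : ∀ t → indicator (sameEdgeSet S (Mset t)) ≡ indicator ⌊ k ≟F t ⌋
  same t = cong indicator (sameEdgeSet-class S≡Mₖ t)

classCount : {A : Set} → (A → EdgeSetP) → List A → Fin 6 → ℕ
classCount S xs k = countL (λ a → sameEdgeSet (S a) (Mset k)) xs

countL-through : {A : Set} (S : A → EdgeSetP) → (∀ a → IsPerfectMatchingP (S a)) → (xs : List A) → ∀ e →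
  countL (λ a → S a e) xs ≡ classCount S xs (through₁ e) + classCount S xs (through₂ e)
countL-through {A} S pm xs e = begin
  countL (λ a → S a e) xs                                   ≡⟨ countL≡sumL _ xs ⟩
  sumL (λ a → indicator (S a e)) xs                         ≡⟨ sumL-cong (λ a → indicator-through (S a) (pm a) e) xs ⟩
  sumL (λ a → indicator (same₁ a) + indicator (same₂ a)) xs ≡⟨ sumL-+ _ _ xs ⟩
  sumL (λ a → indicator (same₁ a)) xs + sumL (λ a → indicator (same₂ a)) xs
    ≡⟨ sym (cong₂ _+_ (countL≡sumL same₁ xs) (countL≡sumL same₂ xs)) ⟩
  classCount S xs (through₁ e) + classCount S xs (through₂ e) ∎
  where
  open ≡-Reasoning
  same₁ same₂ : A → Bool
  same₁ a = sameEdgeSet (S a) (Mset (through₁ e))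
  same₂ a = sameEdgeSet (S a) (Mset (through₂ e))

Mset-isPM : ∀ k → IsPerfectMatchingP (Mset k)
Mset-isPM k x = toWitness (≡true⇒T (allL²-sound isPM sanity-pm (∈-allFin k) (∈-allVertices x)))
  where
  isPM : Fin 6 → Vertex → Bool
  isPM k x = ⌊ countL (λ e → Mset k e ∧ incident x e) allPEdges ≟ℕ 1 ⌋
  ∈-allVertices : ∀ x → x ∈ allVertices
  ∈-allVertices (u i) = ∈-++⁺ˡ (∈-map⁺ u (∈-allFin i))
  ∈-allVertices (v i) = ∈-++⁺ʳ (map u (allFin 5)) (∈-map⁺ v (∈-allFin i))

Mset-¬two-edges-at : ∀ a w {e₁ e₂} → e₁ ≢ e₂ →
  (Mset a e₁ ≡ true × incident w e₁ ≡ true) → (Mset a e₂ ≡ true × incident w e₂ ≡ true) → ⊥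
Mset-¬two-edges-at a w {e₁} {e₂} e₁≢e₂ (a∋e₁ , w∈e₁) (a∋e₂ , w∈e₂) = 2≰1 (subst (2 ≤_) (Mset-isPM a w) atLeastTwo)
  where
  atLeastTwo : 2 ≤ countL (λ e → Mset a e ∧ incident w e) allPEdges
  atLeastTwo = countL≥2 (λ e → Mset a e ∧ incident w e) allPEdges (∈-allPEdges e₁) (∈-allPEdges e₂) e₁≢e₂
                        (cong₂ _∧_ a∋e₁ w∈e₁) (cong₂ _∧_ a∋e₂ w∈e₂)
  2≰1 : ¬ 2 ≤ 1
  2≰1 (s≤s ())

==V-refl : ∀ x → (x ==V x) ≡ true
==V-refl (u i) = ⌊≟F⌋-refl i
==V-refl (v i) = ⌊≟F⌋-refl i

Joins⇒incident : ∀ {e w x} → Joins e w x → incident w e ≡ true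
Joins⇒incident {e} (inj₁ (refl , _)) = cong (_∨ (proj₁ (ends e) ==V proj₂ (ends e))) (==V-refl (proj₁ (ends e)))
Joins⇒incident {e} (inj₂ (_ , refl)) =
  trans (cong ((proj₂ (ends e) ==V proj₁ (ends e)) ∨_) (==V-refl (proj₂ (ends e)))) (∨-zeroʳ _)

Joins-distinct : ∀ {e w x y} → x ≢ y → x ≢ w → Joins e w x → Joins e w y → ⊥
Joins-distinct x≢y x≢w (inj₁ (_ , b≡x)) (inj₁ (_ , b≡y)) = x≢y (trans (sym b≡x) b≡y)
Joins-distinct x≢y x≢w (inj₁ (_ , b≡x)) (inj₂ (_ , b≡w)) = x≢w (trans (sym b≡x) b≡w)
Joins-distinct x≢y x≢w (inj₂ (a≡x , _)) (inj₁ (a≡w , _)) = x≢w (trans (sym a≡x) a≡w)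
Joins-distinct x≢y x≢w (inj₂ (a≡x , _)) (inj₂ (a≡y , _)) = x≢y (trans (sym a≡x) a≡y)

module _ (𝓜 : List PMP) where

  copyIndices : (e : PEdge) → List (Fin (suc (mult 𝓜 e)))
  copyIndices e = allFin (suc (mult 𝓜 e))

  copiesUsed : PMM 𝓜 → PEdge → ℕ
  copiesUsed N e = countL (λ k → proj₁ N (e , k)) (copyIndices e)

  copiesUsed≤1 : ∀ N e → copiesUsed N e ≤ 1
  copiesUsed≤1 N e = begin
    copiesUsed N e                                                 ≡⟨ sym (countL-∧true _ (copyIndices e)) ⟩
    countL (λ k → proj₁ N (e , k) ∧ true) (copyIndices e)          ≡⟨ cong (λ b → countL (λ k → proj₁ N (e , k) ∧ b) (copyIndices e)) (sym x∈e) ⟩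
    countL (λ k → proj₁ N (e , k) ∧ incident x e) (copyIndices e)  ≤⟨ ≤-sumL (λ e → countL (λ k → proj₁ N (e , k) ∧ incident x e) (copyIndices e)) (∈-allPEdges e) ⟩
    degIn 𝓜 (proj₁ N) x                                            ≡⟨ proj₂ N x ⟩
    1                                                              ∎
    where
    open ≤-Reasoning
    x : Vertex
    x = proj₁ (ends e)
    x∈e : incident x e ≡ true
    x∈e = cong (_∨ (x ==V proj₂ (ends e))) (==V-refl x)

  copiesUsed≡indicator : ∀ N e → copiesUsed N e ≡ indicator (underlying {𝓜} N e)
  copiesUsed≡indicator N e = countL≤1⇒≡indicator-anyL _ (copyIndices e) (copiesUsed≤1 N e)

  underlying-isPM : ∀ N → IsPerfectMatchingP (underlying {𝓜} N)
  underlying-isPM N x = begin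
    countL (λ e → underlying {𝓜} N e ∧ incident x e) allPEdges
      ≡⟨ countL≡sumL (λ e → underlying {𝓜} N e ∧ incident x e) allPEdges ⟩
    sumL (λ e → indicator (underlying {𝓜} N e ∧ incident x e)) allPEdges
      ≡⟨ sumL-cong (λ e → indicator-anyL-∧ (λ k → proj₁ N (e , k)) (copyIndices e) (incident x e) (copiesUsed≤1 N e)) allPEdges ⟩
    degIn 𝓜 (proj₁ N) x
      ≡⟨ proj₂ N x ⟩
    1 ∎
    where open ≡-Reasoning

  containing : List (PMM 𝓜) → PEdge → ℕ
  containing 𝓝 e = countL (λ N → underlying {𝓜} N e) 𝓝

  users : List (PMM 𝓜) → (e : PEdge) → Fin (suc (mult 𝓜 e)) → ℕ
  users 𝓝 e k = countL (λ N → proj₁ N (e , k)) 𝓝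

  containing≡sumL-users : ∀ 𝓝 e → containing 𝓝 e ≡ sumL (users 𝓝 e) (copyIndices e)
  containing≡sumL-users 𝓝 e = begin
    containing 𝓝 e                                                          ≡⟨ countL≡sumL (λ N → underlying {𝓜} N e) 𝓝 ⟩
    sumL (λ N → indicator (underlying {𝓜} N e)) 𝓝                            ≡⟨ sumL-cong (λ N → sym (copiesUsed≡indicator N e)) 𝓝 ⟩
    sumL (λ N → copiesUsed N e) 𝓝                                           ≡⟨ sumL-cong (λ N → countL≡sumL (λ k → proj₁ N (e , k)) (copyIndices e)) 𝓝 ⟩
    sumL (λ N → sumL (λ k → indicator (proj₁ N (e , k))) (copyIndices e)) 𝓝 ≡⟨ sumL-swap (λ N k → indicator (proj₁ N (e , k))) 𝓝 (copyIndices e) ⟩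
    sumL (λ k → sumL (λ N → indicator (proj₁ N (e , k))) 𝓝) (copyIndices e) ≡⟨ sumL-cong (λ k → sym (countL≡sumL (λ N → proj₁ N (e , k)) 𝓝)) (copyIndices e) ⟩
    sumL (users 𝓝 e) (copyIndices e)                                        ∎
    where open ≡-Reasoning

  mult≡nP : ∀ e → mult 𝓜 e ≡ nP 𝓜 (through₁ e) + nP 𝓜 (through₂ e)
  mult≡nP = countL-through proj₁ proj₂ 𝓜

  containing≡nNP : ∀ 𝓝 e → containing 𝓝 e ≡ nNP {𝓜} 𝓝 (through₁ e) + nNP {𝓜} 𝓝 (through₂ e)
  containing≡nNP 𝓝 = countL-through (underlying {𝓜}) underlying-isPM 𝓝

  covered⇒copies≤containing : ∀ 𝓝 e → (∀ k → Any (λ N → proj₁ N (e , k) ≡ true) 𝓝) →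
    suc (mult 𝓜 e) ≤ containing 𝓝 e
  covered⇒copies≤containing 𝓝 e covered = begin
    suc (mult 𝓜 e)                    ≡⟨ sym (length-tabulate (λ k → k)) ⟩
    length (copyIndices e)            ≡⟨ sym (sumL-const-1 (copyIndices e)) ⟩
    sumL (λ _ → 1) (copyIndices e)    ≤⟨ sumL-mono-≤ (λ k → Any⇒countL-pos (λ N → proj₁ N (e , k)) (covered k)) (copyIndices e) ⟩
    sumL (users 𝓝 e) (copyIndices e)  ≡⟨ sym (containing≡sumL-users 𝓝 e) ⟩
    containing 𝓝 e                    ∎
    where open ≤-Reasoning

  module _ (𝓝 : List (PMM 𝓜)) (disjoint : AllPairs (Disjoint {𝓜}) 𝓝) where

    containing≤copies : ∀ e → containing 𝓝 e ≤ suc (mult 𝓜 e)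
    containing≤copies e = begin
      containing 𝓝 e                    ≡⟨ containing≡sumL-users 𝓝 e ⟩
      sumL (users 𝓝 e) (copyIndices e)  ≤⟨ sumL-mono-≤ users≤1 (copyIndices e) ⟩
      sumL (λ _ → 1) (copyIndices e)    ≡⟨ sumL-const-1 (copyIndices e) ⟩
      length (copyIndices e)            ≡⟨ length-tabulate (λ k → k) ⟩
      suc (mult 𝓜 e)                    ∎
      where
      open ≤-Reasoning
      users≤1 : ∀ k → users 𝓝 e k ≤ 1
      users≤1 k = countL≤1-AllPairs (λ N → proj₁ N (e , k)) (λ disj → disj (e , k)) disjoint

    excess : Fin 6 → Set
    excess i = nP 𝓜 i < nNP {𝓜} 𝓝 i

    ¬excess-on-shared-edge : ∀ {i j} → i ≢ j → excess i → excess j →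
      ¬ (Σ PEdge λ e → Mset i e ≡ true × Mset j e ≡ true)
    ¬excess-on-shared-edge {i} {j} i≢j excessᵢ excessⱼ (e , i∋e , j∋e) = n≮n _ (begin
      suc (suc (nP 𝓜 i + nP 𝓜 j))                     ≡⟨ cong (1 +_) (sym (+-suc (nP 𝓜 i) (nP 𝓜 j))) ⟩
      suc (nP 𝓜 i) + suc (nP 𝓜 j)                     ≤⟨ +-mono-≤ excessᵢ excessⱼ ⟩
      nNP {𝓜} 𝓝 i + nNP {𝓜} 𝓝 j                       ≡⟨ sym (pair (nNP {𝓜} 𝓝)) ⟩
      nNP {𝓜} 𝓝 (through₁ e) + nNP {𝓜} 𝓝 (through₂ e) ≡⟨ sym (containing≡nNP 𝓝 e) ⟩
      containing 𝓝 e                                  ≤⟨ containing≤copies e ⟩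
      suc (mult 𝓜 e)                                  ≡⟨ cong (1 +_) (mult≡nP e) ⟩
      suc (nP 𝓜 (through₁ e) + nP 𝓜 (through₂ e))     ≡⟨ cong (1 +_) (pair (nP 𝓜)) ⟩
      suc (nP 𝓜 i + nP 𝓜 j)                           ∎)
      where
      open ≤-Reasoning
      pair : (c : Fin 6 → ℕ) → c (through₁ e) + c (through₂ e) ≡ c i + c j
      pair = through-pair {i} {j} {e} i≢j i∋e j∋e

    excess-unique : ∀ i j → excess i → excess j → i ≡ j
    excess-unique i j excessᵢ excessⱼ = decidable-stable (i ≟F j) λ i≢j →
      ¬excess-on-shared-edge i≢j excessᵢ excessⱼ (commonEdge {i} {j} i≢j)

    covered⇒excess : ∀ e → (∀ k → Any (λ N → proj₁ N (e , k) ≡ true) 𝓝) →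
      Σ (Fin 6) λ a → Mset a e ≡ true × excess a
    covered⇒excess e covered = [ (λ excess₁ → through₁ e , proj₁ (through-∈ e) , excess₁)
                               , (λ excess₂ → through₂ e , proj₂ (through-∈ e) , excess₂) ]′ (suc-+-≤⇒<⊎< (begin
      1 + (nP 𝓜 (through₁ e) + nP 𝓜 (through₂ e))     ≡⟨ cong (1 +_) (sym (mult≡nP e)) ⟩
      1 + mult 𝓜 e                                    ≤⟨ covered⇒copies≤containing 𝓝 e covered ⟩
      containing 𝓝 e                                  ≡⟨ containing≡nNP 𝓝 e ⟩
      nNP {𝓜} 𝓝 (through₁ e) + nNP {𝓜} 𝓝 (through₂ e) ∎))
      where open ≤-Reasoning

    ¬covered-cherry : (x y w : Vertex) → x ≢ y → x ≢ w → AdjM 𝓜 w x → AdjM 𝓜 w y →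
      ¬ ((f : EdgeM 𝓜) → (Joins (proj₁ f) w x ⊎ Joins (proj₁ f) w y) → Any (λ N → proj₁ N f ≡ true) 𝓝)
    ¬covered-cherry x y w x≢y x≢w ((e₁ , _) , w-x) ((e₂ , _) , w-y) covered =
      Mset-¬two-edges-at a w e₁≢e₂ (a∋e₁ , Joins⇒incident {e₁} w-x) (a∋e₂ , Joins⇒incident {e₂} w-y)
      where
      excess₁ : Σ (Fin 6) λ a → Mset a e₁ ≡ true × excess a
      excess₁ = covered⇒excess e₁ (λ k → covered (e₁ , k) (inj₁ w-x))
      excess₂ : Σ (Fin 6) λ a → Mset a e₂ ≡ true × excess a
      excess₂ = covered⇒excess e₂ (λ k → covered (e₂ , k) (inj₂ w-y))
      a : Fin 6
      a = proj₁ excess₁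
      a∋e₁ : Mset a e₁ ≡ true
      a∋e₁ = proj₁ (proj₂ excess₁)
      a∋e₂ : Mset a e₂ ≡ true
      a∋e₂ = subst (λ b → Mset b e₂ ≡ true)
                   (sym (excess-unique a (proj₁ excess₂) (proj₂ (proj₂ excess₁)) (proj₂ (proj₂ excess₂))))
                   (proj₁ (proj₂ excess₂))
      e₁≢e₂ : e₁ ≢ e₂
      e₁≢e₂ refl = Joins-distinct {e₁} x≢y x≢w w-x w-y

lemma2p2 : (𝓜 : List PMP) (𝓝 : List (PMM 𝓜)) → AllPairs (Disjoint {𝓜}) 𝓝 →
    ((i j : Fin 6) → nP 𝓜 i < nNP {𝓜} 𝓝 i → nP 𝓜 j < nNP {𝓜} 𝓝 j → i ≡ j)
    × ((x y w : Vertex) → ¬ x ≡ y → ¬ x ≡ w → ¬ y ≡ w →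
        AdjM 𝓜 w x → AdjM 𝓜 w y →
        ¬ ((f : EdgeM 𝓜) → (Joins (proj₁ f) w x ⊎ Joins (proj₁ f) w y) →
            Any (λ N → proj₁ N f ≡ true) 𝓝))
lemma2p2 𝓜 𝓝 disjoint =
  excess-unique 𝓜 𝓝 disjoint , λ x y w x≢y x≢w _ → ¬covered-cherry 𝓜 𝓝 disjoint x y w x≢y x≢w
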